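{- For all integers $1\le s\le t\le r$ and $a\ge 1$, \[ R_{s+a}(r+a,t+a)\ge R_s(r,t)+a. \]
   Context: All hypergraphs are finite. An $r$-uniform hypergraph $\mathcal H$ is $r$-partite if its vertex set can be partitioned as $V(\mathcal H)=P_1\sqcup\dots\sqcup P_r$ such that $|e\cap P_j|=1$ for every edge $e$ and every $j\in[r]$. It is $t$-intersecting if $|e\cap f|\ge t$ for all $e,f\in E(\mathcal H)$. An $(r,t)$-graph is an $r$-uniform, $r$-partite, $t$-intersecting hypergraph. For $s\ge1$, an $s$-cover of $\mathcal H$ is a set $B\subseteq V(\mathcal H)$ with $|B\cap e|\ge s$ for every edge $e$, and $\tau_s(\mathcal H)$ is the minimum size of an $s$-cover. For $1\le s\le t\le r$, $R_s(r,t)$ is the maximum of $\tau_s(\mathcal H)$ over all $(r,t)$-graphs $\mathcal H$. -}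

module Defs where

open import Data.Nat using (ℕ; _≤_)
open import Data.Fin using (Fin; _≟_)
open import Data.Fin.Subset using (Subset; _∩_; ∣_∣)
open import Data.Vec using (tabulate)
open import Data.List using (List)
open import Data.List.Membership.Propositional using (_∈_)
open import Data.Product using (Σ; ∃; _×_)
open import Relation.Nullary.Decidable using (⌊_⌋)
open import Relation.Binary.PropositionalEquality using (_≡_)

record Hypergraph : Set where
  constructor hypergraph
  field
    n     : ℕ
    edges : List (Subset n)
open Hypergraph public

Uniform : ℕ → Hypergraph → Set
Uniform r H = ∀ e → e ∈ edges H → ∣ e ∣ ≡ r

-- The part P_j of a partition given by a labelling V → Fin r.
partClass : {n r : ℕ} → (Fin n → Fin r) → Fin r → Subset n
partClass part j = tabulate (λ v → ⌊ part v ≟ j ⌋)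

Partite : ℕ → Hypergraph → Set
Partite r H = Σ (Fin (n H) → Fin r) λ part →
  ∀ e → e ∈ edges H → ∀ (j : Fin r) → ∣ e ∩ partClass part j ∣ ≡ 1

Intersecting : ℕ → Hypergraph → Set
Intersecting t H = ∀ e f → e ∈ edges H → f ∈ edges H → t ≤ ∣ e ∩ f ∣

IsRTGraph : ℕ → ℕ → Hypergraph → Set
IsRTGraph r t H = Uniform r H × Partite r H × Intersecting t H

IsCover : ℕ → (H : Hypergraph) → Subset (n H) → Set
IsCover s H B = ∀ e → e ∈ edges H → s ≤ ∣ B ∩ e ∣

IsTau : ℕ → Hypergraph → ℕ → Set
IsTau s H m = (Σ (Subset (n H)) λ B → IsCover s H B × ∣ B ∣ ≡ m)
            × (∀ B → IsCover s H B → m ≤ ∣ B ∣)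

IsR : ℕ → ℕ → ℕ → ℕ → Set
IsR s r t m = (Σ Hypergraph λ H → IsRTGraph r t H × IsTau s H m)
            × (∀ H k → IsRTGraph r t H → IsTau s H k → k ≤ m)

module Submission where

-- Given an (r,t)-graph H, append the same a fresh vertices to
-- every edge; the result  ext a H  is an (r+a,t+a)-graph (each new vertex
-- forms a new part on its own).  If H has an edge, then
-- τ_{s+a}(ext a H) = τ_s(H) + a: an s-cover of H plus the new vertices is an
-- (s+a)-cover, and conversely an (s+a)-cover B ++ C (C the new vertices it
-- uses, |C| = k ≤ a) restricts to an (a-k+s)-cover B of H, which has size
-- ≥ (a-k) + τ_s(H) because each vertex removed from a (j+1)-cover leaves a
-- j-cover.  Hence R_{s+a}(r+a,t+a) ≥ τ_s(H) + a for an extremal H.  If the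
-- extremal H has no edges then R_s(r,t) = 0, and the single-edge graph on
-- r+a vertices (whose (s+a)-cover number is s+a) gives the bound directly.

open import Defs
open import Data.Nat using (ℕ; zero; suc; _+_; _≤_; z≤n; s≤s; s≤s⁻¹)
open import Data.Nat.Properties
  using (≤-refl; ≤-trans; ≤-reflexive; n≤1+n; +-comm; +-assoc; +-monoˡ-≤; +-cancelʳ-≤;
         m≤n+m; n≤0⇒n≡0; m≤n⇒∃[o]m+o≡n; module ≤-Reasoning)
open import Data.Bool using (true; false)
open import Data.Fin as Fin using (Fin; _↑ˡ_; _↑ʳ_; splitAt; join)
open import Data.Fin.Properties
  using (splitAt-↑ˡ; splitAt-↑ʳ; join-splitAt; ↑ˡ-injective; ↑ʳ-injective; suc-injective)
open import Data.Fin.Subset using (Subset; _∩_; ∣_∣; ⊤; ⊥; ⁅_⁆; inside; outside)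
open import Data.Fin.Subset.Properties
  using (∣⊤∣≡n; ∣⊥∣≡0; ∣⁅x⁆∣≡1; ∣p∣≤n; ∣p∩q∣≤∣p∣; ∩-identityˡ; ∩-identityʳ; ∩-zeroʳ)
open import Data.Vec as Vec using ([]; _∷_; _++_; tabulate; replicate)
open import Data.Vec.Properties using (tabulate-cong; zipWith-++)
open import Data.List using (map; []; _∷_)
open import Data.List.Membership.Propositional using (_∈_)
open import Data.List.Membership.Propositional.Properties using (∈-map⁻; ∈-map⁺)
open import Data.List.Relation.Unary.Any using (here)
open import Data.Product using (∃; _×_; _,_)
open import Data.Sum as Sum using ([_,_])
open import Function using (_∘_)
open import Function.Definitions using (Injective)
open import Relation.Nullary using (yes; no; contradiction)
open import Relation.Nullary.Decidable using (⌊_⌋; isYes≗does; dec-false)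
open import Relation.Binary.PropositionalEquality

∣++∣ : ∀ {p q} (x : Subset p) (y : Subset q) → ∣ x ++ y ∣ ≡ ∣ x ∣ + ∣ y ∣
∣++∣ []           y = refl
∣++∣ (true  ∷ x)  y = cong suc (∣++∣ x y)
∣++∣ (false ∷ x)  y = ∣++∣ x y

∣++∩++∣ : ∀ {p q} (x z : Subset p) (y w : Subset q) →
          ∣ (x ++ y) ∩ (z ++ w) ∣ ≡ ∣ x ∩ z ∣ + ∣ y ∩ w ∣
∣++∩++∣ x z y w = trans (cong ∣_∣ (zipWith-++ _ x y z w)) (∣++∣ (x ∩ z) (y ∩ w))

∣⊤∩⊤∣ : ∀ a → ∣ ⊤ {a} ∩ ⊤ ∣ ≡ a
∣⊤∩⊤∣ a = trans (cong ∣_∣ (∩-identityʳ (⊤ {a}))) (∣⊤∣≡n a)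

tabulate-++ : ∀ {A : Set} p q (f : Fin (p + q) → A) →
  tabulate f ≡ tabulate (f ∘ (_↑ˡ q)) ++ tabulate (f ∘ (p ↑ʳ_))
tabulate-++ zero    q f = refl
tabulate-++ (suc p) q f = cong (f Fin.zero ∷_) (tabulate-++ p q (f ∘ Fin.suc))

tabulate-const : ∀ {A : Set} n (x : A) → tabulate {n = n} (λ _ → x) ≡ replicate n x
tabulate-const zero    x = refl
tabulate-const (suc n) x = cong (x ∷_) (tabulate-const n x)

↑-elim : ∀ {p q} (P : Fin (p + q) → Set) →
  (∀ i → P (i ↑ˡ q)) → (∀ k → P (p ↑ʳ k)) → ∀ j → P j
↑-elim {p} {q} P left right j =
  subst P (join-splitAt p q j) ([_,_] {C = P ∘ join p q} left right (splitAt p j))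

≟-injective : ∀ {m n} (f : Fin m → Fin n) → Injective _≡_ _≡_ f →
  ∀ x y → ⌊ f x Fin.≟ f y ⌋ ≡ ⌊ x Fin.≟ y ⌋
≟-injective f inj x y with x Fin.≟ y | f x Fin.≟ f y
... | yes _    | yes _     = refl
... | no _     | no _      = refl
... | yes refl | no fx≢fx  = contradiction refl fx≢fx
... | no x≢y   | yes fx≡fy = contradiction (inj fx≡fy) x≢y

≟-distinct : ∀ {n} {x y : Fin n} → x ≢ y → ⌊ x Fin.≟ y ⌋ ≡ false
≟-distinct {x = x} {y} x≢y = trans (isYes≗does (x Fin.≟ y)) (dec-false (x Fin.≟ y) x≢y)

↑ˡ≢↑ʳ : ∀ {p q} (i : Fin p) (k : Fin q) → i ↑ˡ q ≢ p ↑ʳ k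
↑ˡ≢↑ʳ {p} {q} i k eq with trans (sym (splitAt-↑ˡ p i q)) (trans (cong (splitAt p) eq) (splitAt-↑ʳ p q k))
... | ()

partClass-id : ∀ {n} (j : Fin n) → partClass (λ v → v) j ≡ ⁅ j ⁆
partClass-id {suc n} Fin.zero    = cong (inside ∷_) (tabulate-const n outside)
partClass-id {suc n} (Fin.suc j) = cong (outside ∷_) (begin
    tabulate (λ v → ⌊ Fin.suc v Fin.≟ Fin.suc j ⌋) ≡⟨ tabulate-cong (λ v → ≟-injective Fin.suc suc-injective v j) ⟩
    partClass (λ v → v) j                           ≡⟨ partClass-id j ⟩
    ⁅ j ⁆                                            ∎)
  where open ≡-Reasoning

∣⊤∩⁅j⁆∣ : ∀ {n} (j : Fin n) → ∣ ⊤ ∩ ⁅ j ⁆ ∣ ≡ 1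
∣⊤∩⁅j⁆∣ j = trans (cong ∣_∣ (∩-identityˡ ⁅ j ⁆)) (∣⁅x⁆∣≡1 j)

-- The labelling of Fin (N + a) by Fin (r + a) that keeps  part  on the old
-- vertices and puts each new vertex into a new part of its own.
extPart : ∀ {N r} a → (Fin N → Fin r) → Fin (N + a) → Fin (r + a)
extPart {N} {r} a part = join r a ∘ Sum.map₁ part ∘ splitAt N

module _ {N r : ℕ} (a : ℕ) (part : Fin N → Fin r) where

  extPart-↑ˡ : ∀ i → extPart a part (i ↑ˡ a) ≡ part i ↑ˡ a
  extPart-↑ˡ i rewrite splitAt-↑ˡ N i a = refl

  extPart-↑ʳ : ∀ k → extPart a part (N ↑ʳ k) ≡ r ↑ʳ k
  extPart-↑ʳ k rewrite splitAt-↑ʳ N a k = refl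

  extClass-↑ˡ : ∀ j → partClass (extPart a part) (j ↑ˡ a) ≡ partClass part j ++ ⊥
  extClass-↑ˡ j = trans (tabulate-++ N a _) (cong₂ _++_
    (tabulate-cong λ i → trans (cong (λ z → ⌊ z Fin.≟ j ↑ˡ a ⌋) (extPart-↑ˡ i))
                                (≟-injective (_↑ˡ a) (↑ˡ-injective a _ _) (part i) j))
    (trans (tabulate-cong λ k → trans (cong (λ z → ⌊ z Fin.≟ j ↑ˡ a ⌋) (extPart-↑ʳ k))
                                       (≟-distinct (↑ˡ≢↑ʳ j k ∘ sym)))
           (tabulate-const a outside)))

  extClass-↑ʳ : ∀ k → partClass (extPart a part) (r ↑ʳ k) ≡ ⊥ ++ ⁅ k ⁆
  extClass-↑ʳ k = trans (tabulate-++ N a _) (cong₂ _++_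
    (trans (tabulate-cong λ i → trans (cong (λ z → ⌊ z Fin.≟ r ↑ʳ k ⌋) (extPart-↑ˡ i))
                                       (≟-distinct (↑ˡ≢↑ʳ (part i) k)))
           (tabulate-const N outside))
    (trans (tabulate-cong λ k′ → trans (cong (λ z → ⌊ z Fin.≟ r ↑ʳ k ⌋) (extPart-↑ʳ k′))
                                        (≟-injective (r ↑ʳ_) (↑ʳ-injective r _ _) k′ k))
           (partClass-id k)))

  extTransversal : ∀ (e : Subset N) → (∀ j → ∣ e ∩ partClass part j ∣ ≡ 1) →
    ∀ j′ → ∣ (e ++ ⊤ {a}) ∩ partClass (extPart a part) j′ ∣ ≡ 1
  extTransversal e transversal = ↑-elim _ old new
    where
    open ≡-Reasoning
    old : ∀ j → ∣ (e ++ ⊤) ∩ partClass (extPart a part) (j ↑ˡ a) ∣ ≡ 1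
    old j = begin
      ∣ (e ++ ⊤) ∩ partClass (extPart a part) (j ↑ˡ a) ∣ ≡⟨ cong (λ c → ∣ (e ++ ⊤) ∩ c ∣) (extClass-↑ˡ j) ⟩
      ∣ (e ++ ⊤) ∩ (partClass part j ++ ⊥) ∣           ≡⟨ ∣++∩++∣ e _ ⊤ ⊥ ⟩
      ∣ e ∩ partClass part j ∣ + ∣ ⊤ {a} ∩ ⊥ ∣          ≡⟨ cong₂ _+_ (transversal j) (trans (cong ∣_∣ (∩-zeroʳ (⊤ {a}))) (∣⊥∣≡0 a)) ⟩
      1                                                 ∎
    new : ∀ k → ∣ (e ++ ⊤) ∩ partClass (extPart a part) (r ↑ʳ k) ∣ ≡ 1
    new k = begin
      ∣ (e ++ ⊤) ∩ partClass (extPart a part) (r ↑ʳ k) ∣ ≡⟨ cong (λ c → ∣ (e ++ ⊤) ∩ c ∣) (extClass-↑ʳ k) ⟩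
      ∣ (e ++ ⊤) ∩ (⊥ ++ ⁅ k ⁆) ∣                        ≡⟨ ∣++∩++∣ e ⊥ ⊤ ⁅ k ⁆ ⟩
      ∣ e ∩ ⊥ ∣ + ∣ ⊤ ∩ ⁅ k ⁆ ∣                          ≡⟨ cong₂ _+_ (trans (cong ∣_∣ (∩-zeroʳ e)) (∣⊥∣≡0 N)) (∣⊤∩⁅j⁆∣ k) ⟩
      1                                                  ∎

ext : ℕ → Hypergraph → Hypergraph
ext a H = hypergraph (n H + a) (map (_++ ⊤ {a}) (edges H))

ext-edge : ∀ a H e′ → e′ ∈ edges (ext a H) → ∃ λ e → e ∈ edges H × e′ ≡ e ++ ⊤ {a}
ext-edge a H e′ = ∈-map⁻ (_++ ⊤ {a})

ext-isRTGraph : ∀ r t a H → IsRTGraph r t H → IsRTGraph (r + a) (t + a) (ext a H)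
ext-isRTGraph r t a H (uniform , (part , transversal) , intersecting) =
  uniform′ , (extPart a part , transversal′) , intersecting′
  where
  uniform′ : Uniform (r + a) (ext a H)
  uniform′ e′ e′∈ with ext-edge a H e′ e′∈
  ... | e , e∈ , refl = trans (∣++∣ e ⊤) (cong₂ _+_ (uniform e e∈) (∣⊤∣≡n a))
  transversal′ : ∀ e′ → e′ ∈ edges (ext a H) → ∀ j → ∣ e′ ∩ partClass (extPart a part) j ∣ ≡ 1
  transversal′ e′ e′∈ with ext-edge a H e′ e′∈
  ... | e , e∈ , refl = extTransversal a part e (transversal e e∈)
  intersecting′ : Intersecting (t + a) (ext a H)
  intersecting′ e′ f′ e′∈ f′∈ with ext-edge a H e′ e′∈ | ext-edge a H f′ f′∈
  ... | e , e∈ , refl | f , f∈ , refl =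
    subst (t + a ≤_) (sym (trans (∣++∩++∣ e f ⊤ ⊤) (cong (∣ e ∩ f ∣ +_) (∣⊤∩⊤∣ a))))
      (+-monoˡ-≤ a (intersecting e f e∈ f∈))

dropFirst : ∀ {p} → Subset p → Subset p
dropFirst []          = []
dropFirst (true  ∷ x) = false ∷ x
dropFirst (false ∷ x) = false ∷ dropFirst x

∣dropFirst∣ : ∀ {p} (x : Subset p) → 1 ≤ ∣ x ∣ → suc ∣ dropFirst x ∣ ≡ ∣ x ∣
∣dropFirst∣ (true  ∷ x) _  = refl
∣dropFirst∣ (false ∷ x) nz = ∣dropFirst∣ x nz

∣dropFirst∩∣ : ∀ {p} (x e : Subset p) → ∣ x ∩ e ∣ ≤ suc ∣ dropFirst x ∩ e ∣
∣dropFirst∩∣ []          []          = z≤n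
∣dropFirst∩∣ (true  ∷ x) (true  ∷ e) = ≤-refl
∣dropFirst∩∣ (true  ∷ x) (false ∷ e) = n≤1+n _
∣dropFirst∩∣ (false ∷ x) (true  ∷ e) = ∣dropFirst∩∣ x e
∣dropFirst∩∣ (false ∷ x) (false ∷ e) = ∣dropFirst∩∣ x e

-- In a hypergraph with an edge, if every s-cover has size ≥ μ, then every
-- (j+s)-cover has size ≥ j+μ: dropping a vertex of a (j+1+s)-cover leaves a
-- (j+s)-cover.
cover-lower-bound : ∀ s H μ (e₀ : Subset (n H)) → e₀ ∈ edges H →
  (∀ B → IsCover s H B → μ ≤ ∣ B ∣) →
  ∀ j B → IsCover (j + s) H B → j + μ ≤ ∣ B ∣
cover-lower-bound s H μ e₀ e₀∈ lower zero    B cover = lower B cover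
cover-lower-bound s H μ e₀ e₀∈ lower (suc j) B cover =
  subst (suc (j + μ) ≤_) (∣dropFirst∣ B B-nonempty)
    (s≤s (cover-lower-bound s H μ e₀ e₀∈ lower j (dropFirst B) dropped-cover))
  where
  B-nonempty : 1 ≤ ∣ B ∣
  B-nonempty = ≤-trans (s≤s z≤n) (≤-trans (cover e₀ e₀∈) (∣p∩q∣≤∣p∣ B e₀))
  dropped-cover : IsCover (j + s) H (dropFirst B)
  dropped-cover e e∈ = s≤s⁻¹ (≤-trans (cover e e∈) (∣dropFirst∩∣ B e))

+-shuffle : ∀ x k d → x + (k + d) ≡ (d + x) + k
+-shuffle x k d = begin
  x + (k + d)  ≡⟨ cong (x +_) (+-comm k d) ⟩
  x + (d + k)  ≡⟨ +-assoc x d k ⟨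
  (x + d) + k  ≡⟨ cong (_+ k) (+-comm x d) ⟩
  (d + x) + k  ∎
  where open ≡-Reasoning

ext-isTau : ∀ s a H μ (e₀ : Subset (n H)) → e₀ ∈ edges H → IsTau s H μ →
  IsTau (s + a) (ext a H) (μ + a)
ext-isTau s a H μ e₀ e₀∈ ((B₀ , B₀-cover , ∣B₀∣) , lower) =
  (B₀ ++ ⊤ , extended-cover , trans (∣++∣ B₀ ⊤) (cong₂ _+_ ∣B₀∣ (∣⊤∣≡n a))) , lower′
  where
  extended-cover : IsCover (s + a) (ext a H) (B₀ ++ ⊤)
  extended-cover e′ e′∈ with ext-edge a H e′ e′∈
  ... | e , e∈ , refl =
    subst (s + a ≤_) (sym (trans (∣++∩++∣ B₀ e ⊤ ⊤) (cong (∣ B₀ ∩ e ∣ +_) (∣⊤∩⊤∣ a))))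
      (+-monoˡ-≤ a (B₀-cover e e∈))

  -- An (s+a)-cover using k new vertices, a = k + d, restricts to a
  -- (d+s)-cover of H.
  lower′ : ∀ B′ → IsCover (s + a) (ext a H) B′ → μ + a ≤ ∣ B′ ∣
  lower′ B′ cover with Vec.splitAt (n H) B′
  ... | B , C , refl with m≤n⇒∃[o]m+o≡n (∣p∣≤n C)
  ... | d , k+d≡a = subst₂ _≤_ (trans (sym (+-shuffle μ ∣ C ∣ d)) (cong (μ +_) k+d≡a)) (sym (∣++∣ B C))
                     (+-monoˡ-≤ ∣ C ∣ (cover-lower-bound s H μ e₀ e₀∈ lower d B restricted))
    where
    restricted : IsCover (d + s) H B
    restricted e e∈ = +-cancelʳ-≤ ∣ C ∣ (d + s) (∣ B ∩ e ∣)
      (subst₂ _≤_ (trans (cong (s +_) (sym k+d≡a)) (+-shuffle s ∣ C ∣ d))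
              (trans (∣++∩++∣ B e C ⊤) (cong (∣ B ∩ e ∣ +_) (cong ∣_∣ (∩-identityʳ C))))
              (cover (e ++ ⊤) (∈-map⁺ (_++ ⊤ {a}) e∈)))

singleEdge : ℕ → Hypergraph
singleEdge n = hypergraph n (⊤ ∷ [])

singleEdge-isRTGraph : ∀ n t → t ≤ n → IsRTGraph n t (singleEdge n)
singleEdge-isRTGraph n t t≤n = uniform , ((λ v → v) , transversal) , intersecting
  where
  uniform : Uniform n (singleEdge n)
  uniform e (here refl) = ∣⊤∣≡n n
  transversal : ∀ e → e ∈ edges (singleEdge n) → ∀ j → ∣ e ∩ partClass (λ v → v) j ∣ ≡ 1
  transversal e (here refl) j = trans (cong (λ c → ∣ ⊤ ∩ c ∣) (partClass-id j)) (∣⊤∩⁅j⁆∣ j)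
  intersecting : Intersecting t (singleEdge n)
  intersecting e f (here refl) (here refl) = subst (t ≤_) (sym (∣⊤∩⊤∣ n)) t≤n

initialSegment : ∀ {s n} → s ≤ n → Subset n
initialSegment z≤n       = ⊥
initialSegment (s≤s s≤n) = inside ∷ initialSegment s≤n

∣initialSegment∣ : ∀ {s n} (s≤n : s ≤ n) → ∣ initialSegment s≤n ∣ ≡ s
∣initialSegment∣ {n = n} z≤n = ∣⊥∣≡0 n
∣initialSegment∣ (s≤s s≤n)   = cong suc (∣initialSegment∣ s≤n)

singleEdge-isTau : ∀ s n → s ≤ n → IsTau s (singleEdge n) s
singleEdge-isTau s n s≤n = (B , cover , ∣initialSegment∣ s≤n) , lower
  where
  B = initialSegment s≤n
  cover : IsCover s (singleEdge n) B
  cover e (here refl) = ≤-reflexive (sym (trans (cong ∣_∣ (∩-identityʳ B)) (∣initialSegment∣ s≤n)))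
  lower : ∀ B′ → IsCover s (singleEdge n) B′ → s ≤ ∣ B′ ∣
  lower B′ cover′ = subst (s ≤_) (cong ∣_∣ (∩-identityʳ B′)) (cover′ ⊤ (here refl))

edgeless-isTau-0 : ∀ s N μ → IsTau s (hypergraph N []) μ → μ ≡ 0
edgeless-isTau-0 s N μ (_ , lower) = n≤0⇒n≡0 (≤-trans (lower ⊥ (λ _ ())) (≤-reflexive (∣⊥∣≡0 N)))

lemma3p9 : (s t r a : ℕ) → 1 ≤ s → s ≤ t → t ≤ r → 1 ≤ a →
    (m m′ : ℕ) → IsR s r t m → IsR (s + a) (r + a) (t + a) m′ →
    m + a ≤ m′
lemma3p9 s t r a _ s≤t t≤r _ m m′ ((H@(hypergraph _ (e₀ ∷ _)) , rt , τ) , _) (_ , maximal) =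
  maximal (ext a H) (m + a) (ext-isRTGraph r t a H rt) (ext-isTau s a H m e₀ (here refl) τ)
lemma3p9 s t r a _ s≤t t≤r _ m m′ ((hypergraph N [] , _ , τ) , _) (_ , maximal) = begin
  m + a  ≡⟨ cong (_+ a) (edgeless-isTau-0 s N m τ) ⟩
  a      ≤⟨ m≤n+m a s ⟩
  s + a  ≤⟨ maximal (singleEdge (r + a)) (s + a) (singleEdge-isRTGraph (r + a) (t + a) (+-monoˡ-≤ a t≤r))
                     (singleEdge-isTau (s + a) (r + a) (+-monoˡ-≤ a (≤-trans s≤t t≤r))) ⟩
  m′     ∎
  where open ≤-Reasoning
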